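{- Let $p\ge 5$ be a prime and let $D$ be a nontrivial regular $(v,k,\lambda,\mu)$-PDS in an Abelian group of order $v=8p^3$ with $k\le v/2$. Then $\Delta=(\lambda-\mu)^2+4(k-\mu)\neq 4p^2$.
   Context: Let $G$ be a finite Abelian group of order $v$ with identity $e$, and $D\subseteq G$ a subset of size $k$. $D$ is a $(v,k,\lambda,\mu)$-partial difference set (PDS) in $G$ if the expressions $gh^{ -1}$ with $g,h\in D$, $g\neq h$, represent each non-identity element of $D$ exactly $\lambda$ times and each non-identity element of $G$ not in $D$ exactly $\mu$ times. $D$ is regular if moreover $D^{(-1)}=D$ and $e\notin D$. A regular PDS $D$ is trivial if $D\cup\{e\}$ or $G\setminus D$ is a subgroup of $G$. -}

module Defs where

open import Level using (0ℓ)
open import Data.Bool using (Bool; true; false; _∧_; not)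
import Data.Bool
open import Data.Nat using (ℕ)
import Data.Sum
open import Data.Product using (_×_; _,_)
open import Data.List using (List; length; filterᵇ; cartesianProduct)
open import Data.List.Membership.Propositional using (_∈_)
open import Data.List.Relation.Unary.Unique.Propositional using (Unique)
open import Relation.Binary.PropositionalEquality using (_≡_; _≢_)
open import Relation.Binary.Definitions using (DecidableEquality)
open import Relation.Nullary.Decidable using (isYes)
open import Algebra.Structures using (IsAbelianGroup)

record FiniteAbelianGroup : Set₁ where
  infixl 7 _∙_
  field
    Carrier : Set
    _∙_     : Carrier → Carrier → Carrier
    e       : Carrier
    _⁻¹     : Carrier → Carrier
    isAbelianGroup : IsAbelianGroup _≡_ _∙_ e _⁻¹
    _≟_     : DecidableEquality Carrier
    elems   : List Carrier
    elems-unique   : Unique elems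
    elems-complete : ∀ x → x ∈ elems

  order : ℕ
  order = length elems

  Subset : Set
  Subset = Carrier → Bool

  size : Subset → ℕ
  size D = length (filterᵇ D elems)

  reps : Subset → Carrier → ℕ
  reps D x = length (filterᵇ ok (cartesianProduct elems elems))
    where
    ok : Carrier × Carrier → Bool
    ok (g , h) = D g ∧ D h ∧ not (isYes (g ≟ h)) ∧ isYes ((g ∙ (h ⁻¹)) ≟ x)

  IsPDS : Subset → ℕ → ℕ → ℕ → ℕ → Set
  IsPDS D v k λ′ μ =
    (order ≡ v) × (size D ≡ k) ×
    (∀ x → x ≢ e → D x ≡ true → reps D x ≡ λ′) ×
    (∀ x → x ≢ e → D x ≡ false → reps D x ≡ μ)

  IsRegular : Subset → Set
  IsRegular D = (∀ g → D (g ⁻¹) ≡ D g) × (D e ≡ false)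

  IsSubgroup : Subset → Set
  IsSubgroup S = (S e ≡ true) ×
    (∀ g h → S g ≡ true → S h ≡ true → S (g ∙ h) ≡ true) ×
    (∀ g → S g ≡ true → S (g ⁻¹) ≡ true)

  withIdentity : Subset → Subset
  withIdentity D x = D x Data.Bool.∨ isYes (x ≟ e)

  complement : Subset → Subset
  complement D x = not (D x)

  IsTrivial : Subset → Set
  IsTrivial D = IsSubgroup (withIdentity D) Data.Sum.⊎ IsSubgroup (complement D)

-- Assuming the discriminant equals 4p², we show μ = 0; but a regular PDS with μ = 0
-- is trivial, because a product g h ∉ D ∪ {e} of elements of D would be the quotient
-- g (h⁻¹)⁻¹ of two elements of D and so be counted by μ.
--   Counting ordered pairs of D by their quotient gives the PDS equation
-- k(k - 1) = λ′k + μ(v - k - 1), and a non-identity element outside D (which exists since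
-- k ≤ v/2) shows μ ≤ k.  The rest is arithmetic: Δ = 4p² forces λ′ - μ = ±2t with
-- t² + k = p² + μ; the PDS equation then makes p² + vμ = p²(1 + 8pμ) a square A², so
-- A = Bp with B² = 1 + 8pμ.  The bounds k ≤ 4p³ and t ≤ p confine B to B ≤ p (through a
-- quadratic inequality in B), and then p ∣ (B - 1)(B + 1) with p odd forces μ = 0.

module Submission where

open import Defs
open import Data.Nat using (ℕ; _≤_; _*_; _^_)
open import Data.Nat.Primality using (Prime)
open import Data.Integer using (ℤ; +_; _-_) renaming (_*_ to _*ℤ_; _+_ to _+ℤ_)
open import Data.Product using (_×_)
open import Relation.Binary.PropositionalEquality using (_≡_; _≢_)
open import Relation.Nullary using (¬_)

open import Level using (0ℓ)
open import Function using (_∘_; id)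
open import Data.Empty using (⊥-elim)
open import Data.Bool using (Bool; true; false; _∧_; not) renaming (_≟_ to _≟ᵇ_)
open import Data.Product using (∃; _,_; proj₁; proj₂)
open import Data.Sum using (_⊎_; inj₁; inj₂; [_,_]′)
open import Data.List using (List; []; _∷_; _++_; map; length; filterᵇ; cartesianProduct)
open import Data.List.Membership.Propositional using (_∈_)
open import Data.List.Relation.Unary.Any using (here; there; any?; satisfied)
open import Data.List.Relation.Unary.All as All using (All; []; _∷_)
open import Data.List.Relation.Unary.All.Properties using (¬Any⇒All¬)
open import Data.List.Relation.Unary.AllPairs using (_∷_)
open import Data.List.Relation.Unary.Unique.Propositional using (Unique)
open import Relation.Binary.PropositionalEquality
  using (refl; sym; trans; cong; cong₂; subst; subst₂; module ≡-Reasoning)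
open import Relation.Nullary using (Dec; yes; no; ¬?)
open import Relation.Nullary.Decidable using (isYes; isYes≗does; dec-true; dec-false; _×-dec_)
open import Data.Nat using (zero; suc; _+_; _<_; >-nonZero; z≤n; s≤s)
open import Data.Nat.Properties
  using (suc-injective; _≤?_; ≤-refl; ≤-trans; ≤-reflexive; ≤-total; <⇒≱; ≰⇒>; m≤n⇒∃[o]m+o≡n;
         +-assoc; +-comm; +-identityʳ; +-cancelʳ-≡; m+1+n≢m;
         *-assoc; *-comm; *-identityˡ; *-identityʳ; *-zeroʳ; *-distribˡ-+;
         *-cancelˡ-≡; *-cancelʳ-≡; m*n≢0; m*n≡0⇒m≡0;
         +-mono-≤; +-monoˡ-≤; +-monoʳ-≤; +-cancelˡ-≤; +-cancelʳ-≤; m≤m+n; m≤n+m;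
         *-monoʳ-≤; *-mono-<; *-cancelˡ-≤; *-cancelʳ-≤; m≤m*n; ^-monoˡ-≤; module ≤-Reasoning)
open import Data.Nat.Divisibility using (_∣_; divides; ∣m+n∣m⇒∣n)
open import Data.Nat.Primality using (prime; 2-rough; euclidsLemma; prime⇒irreducible; prime⇒nonZero)
open import Data.Nat.Tactic.RingSolver using (solve-∀)
open import Data.Integer.Tactic.RingSolver renaming (solve-∀ to ℤ-solve-∀)
import Data.Integer.Properties as ℤ

sumOver : {A : Set} → List A → (A → ℕ) → ℕ
sumOver []       f = 0
sumOver (x ∷ xs) f = f x + sumOver xs f

module _ {A : Set} where

  sumOver-cong : (L : List A) {f g : A → ℕ} → (∀ x → f x ≡ g x) → sumOver L f ≡ sumOver L g
  sumOver-cong []       f≗g = refl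
  sumOver-cong (x ∷ xs) f≗g = cong₂ _+_ (f≗g x) (sumOver-cong xs f≗g)

  sumOver-zero : {L : List A} {f : A → ℕ} → All (λ x → f x ≡ 0) L → sumOver L f ≡ 0
  sumOver-zero []           = refl
  sumOver-zero (fx≡0 ∷ all) rewrite fx≡0 = sumOver-zero all

  sumOver-+ : (L : List A) (f g : A → ℕ) →
    sumOver L (λ x → f x + g x) ≡ sumOver L f + sumOver L g
  sumOver-+ []       f g = refl
  sumOver-+ (x ∷ xs) f g rewrite sumOver-+ xs f g = interchange (f x) (g x) (sumOver xs f) (sumOver xs g)
    where
    interchange : ∀ a b c d → a + b + (c + d) ≡ a + c + (b + d)
    interchange = solve-∀

  sumOver-*ˡ : (L : List A) (c : ℕ) (f : A → ℕ) → sumOver L (λ x → c * f x) ≡ c * sumOver L f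
  sumOver-*ˡ []       c f = sym (*-zeroʳ c)
  sumOver-*ˡ (x ∷ xs) c f = trans (cong (_+_ (c * f x)) (sumOver-*ˡ xs c f)) (sym (*-distribˡ-+ c (f x) _))

  sumOver-mono : (L : List A) {f g : A → ℕ} → (∀ x → f x ≤ g x) → sumOver L f ≤ sumOver L g
  sumOver-mono []       f≤g = z≤n
  sumOver-mono (x ∷ xs) f≤g = +-mono-≤ (f≤g x) (sumOver-mono xs f≤g)

  term≤sumOver : {L : List A} (f : A → ℕ) {y : A} → y ∈ L → f y ≤ sumOver L f
  term≤sumOver {x ∷ xs} f (here refl) = m≤m+n (f x) _
  term≤sumOver {x ∷ xs} f (there y∈xs) = ≤-trans (term≤sumOver f y∈xs) (m≤n+m _ (f x))

  sumOver-length : (L : List A) → sumOver L (λ _ → 1) ≡ length L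
  sumOver-length []       = refl
  sumOver-length (x ∷ xs) = cong suc (sumOver-length xs)

  sumOver-++ : (xs ys : List A) (f : A → ℕ) → sumOver (xs ++ ys) f ≡ sumOver xs f + sumOver ys f
  sumOver-++ []       ys f = refl
  sumOver-++ (x ∷ xs) ys f = trans (cong (_+_ (f x)) (sumOver-++ xs ys f)) (sym (+-assoc (f x) _ _))

  sumOver-point : {L : List A} {f : A → ℕ} {y : A} → Unique L → y ∈ L →
    (∀ x → x ≢ y → f x ≡ 0) → sumOver L f ≡ f y
  sumOver-point {x ∷ xs} {f} (x∉xs ∷ _) (here refl) off-y =
    trans (cong (_+_ (f x)) (sumOver-zero (All.map (λ x≢z → off-y _ (x≢z ∘ sym)) x∉xs))) (+-comm (f x) 0)
  sumOver-point {x ∷ xs} {f} (x∉xs ∷ uniq) (there y∈xs) off-y =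
    trans (cong (_+ sumOver xs f) (off-y x (λ { refl → All.lookup x∉xs y∈xs refl })))
          (sumOver-point uniq y∈xs off-y)

sumOver-map : {A B : Set} (g : A → B) (xs : List A) (f : B → ℕ) →
  sumOver (map g xs) f ≡ sumOver xs (f ∘ g)
sumOver-map g []       f = refl
sumOver-map g (x ∷ xs) f = cong (_+_ (f (g x))) (sumOver-map g xs f)

sumOver-cartesian : {A B : Set} (xs : List A) (ys : List B) (f : A × B → ℕ) →
  sumOver (cartesianProduct xs ys) f ≡ sumOver xs (λ a → sumOver ys (λ b → f (a , b)))
sumOver-cartesian []       ys f = refl
sumOver-cartesian (x ∷ xs) ys f =
  trans (sumOver-++ (map (x ,_) ys) (cartesianProduct xs ys) f)
        (cong₂ _+_ (sumOver-map (x ,_) ys f) (sumOver-cartesian xs ys f))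

sumOver-swap : {A B : Set} (xs : List A) (ys : List B) (f : A → B → ℕ) →
  sumOver xs (λ a → sumOver ys (f a)) ≡ sumOver ys (λ b → sumOver xs (λ a → f a b))
sumOver-swap []       ys f = sym (sumOver-zero (All.universal (λ _ → refl) ys))
sumOver-swap (x ∷ xs) ys f =
  trans (cong (_+_ (sumOver ys (f x))) (sumOver-swap xs ys f))
        (sym (sumOver-+ ys (f x) (λ b → sumOver xs (λ a → f a b))))

ind : Bool → ℕ
ind true  = 1
ind false = 0

ind≤1 : ∀ b → ind b ≤ 1
ind≤1 true  = ≤-refl
ind≤1 false = z≤n

ind-idem : ∀ b → ind b * ind b ≡ ind b
ind-idem true  = refl
ind-idem false = refl

ind-not : ∀ b → ind (not b) + ind b ≡ 1
ind-not true  = refl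
ind-not false = refl

ind-∧⁴ : ∀ a b c d → ind (a ∧ b ∧ c ∧ d) ≡ ind a * ind b * ind c * ind d
ind-∧⁴ false b     c     d     = refl
ind-∧⁴ true  false c     d     = refl
ind-∧⁴ true  true  false d     = refl
ind-∧⁴ true  true  true  false = refl
ind-∧⁴ true  true  true  true  = refl

length-filterᵇ : {A : Set} (P : A → Bool) (L : List A) → length (filterᵇ P L) ≡ sumOver L (ind ∘ P)
length-filterᵇ P []       = refl
length-filterᵇ P (x ∷ xs) with P x
... | true  = cong suc (length-filterᵇ P xs)
... | false = length-filterᵇ P xs

isYes-true : {P : Set} (P? : Dec P) → P → isYes P? ≡ true
isYes-true P? p = trans (isYes≗does P?) (dec-true P? p)

isYes-false : {P : Set} (P? : Dec P) → ¬ P → isYes P? ≡ false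
isYes-false P? ¬p = trans (isYes≗does P?) (dec-false P? ¬p)

module Counting (G : FiniteAbelianGroup) where
  open FiniteAbelianGroup G
  open import Algebra.Bundles using (Group)
  open import Algebra.Structures using (IsAbelianGroup)

  group : Group 0ℓ 0ℓ
  group = record { isGroup = IsAbelianGroup.isGroup isAbelianGroup }

  open Group group using (inverseʳ)
  open import Algebra.Properties.Group group
    using (⁻¹-anti-homo-//; ⁻¹-anti-homo-\\; //-rightDividesˡ; \\-leftDividesˡ; x∙y⁻¹≈ε⇒x≈y; ⁻¹-involutive)

  ∑ : (Carrier → ℕ) → ℕ
  ∑ = sumOver elems

  δ : Carrier → Carrier → ℕ
  δ a b = ind (isYes (a ≟ b))

  δ-self : ∀ a → δ a a ≡ 1
  δ-self a = cong ind (isYes-true (a ≟ a) refl)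

  δ-distinct : ∀ {a b} → a ≢ b → δ a b ≡ 0
  δ-distinct {a} {b} a≢b = cong ind (isYes-false (a ≟ b) a≢b)

  ∑-δ : (f : Carrier → ℕ) (y : Carrier) → ∑ (λ x → f x * δ y x) ≡ f y
  ∑-δ f y = trans (sumOver-point elems-unique (elems-complete y) vanishes)
                  (trans (cong (f y *_) (δ-self y)) (*-identityʳ (f y)))
    where
    vanishes : ∀ x → x ≢ y → f x * δ y x ≡ 0
    vanishes x x≢y = trans (cong (f x *_) (δ-distinct (x≢y ∘ sym))) (*-zeroʳ (f x))

  size-as-sum : (S : Subset) → size S ≡ ∑ (ind ∘ S)
  size-as-sum S = length-filterᵇ S elems

  size-complement : (S : Subset) → size (complement S) + size S ≡ order
  size-complement S = begin
    size (complement S) + size S        ≡⟨ cong₂ _+_ (size-as-sum (complement S)) (size-as-sum S) ⟩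
    ∑ (ind ∘ complement S) + ∑ (ind ∘ S) ≡⟨ sym (sumOver-+ elems _ _) ⟩
    ∑ (λ x → ind (not (S x)) + ind (S x)) ≡⟨ sumOver-cong elems (ind-not ∘ S) ⟩
    ∑ (λ _ → 1)                          ≡⟨ sumOver-length elems ⟩
    order                                ∎
    where open ≡-Reasoning

  //-solve : ∀ {g h x} → g ∙ h ⁻¹ ≡ x → h ≡ x ⁻¹ ∙ g
  //-solve {g} {h} refl = sym (trans (cong (_∙ g) (⁻¹-anti-homo-// g h)) (//-rightDividesˡ g h))

  //-solution : ∀ g x → g ∙ (x ⁻¹ ∙ g) ⁻¹ ≡ x
  //-solution g x = trans (cong (g ∙_) (⁻¹-anti-homo-\\ x g)) (\\-leftDividesˡ g x)

  ordered : Subset → Carrier → Carrier → ℕ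
  ordered S g h = ind (S g) * ind (S h) * ind (not (isYes (g ≟ h)))

  reps-as-sum : (S : Subset) (x : Carrier) →
    reps S x ≡ ∑ (λ g → ∑ (λ h → ordered S g h * δ (g ∙ h ⁻¹) x))
  reps-as-sum S x =
    trans (length-filterᵇ _ (cartesianProduct elems elems))
          (trans (sumOver-cartesian elems elems _)
                 (sumOver-cong elems λ g → sumOver-cong elems λ h →
                   ind-∧⁴ (S g) (S h) (not (isYes (g ≟ h))) (isYes ((g ∙ h ⁻¹) ≟ x))))

  reps-at-identity : (S : Subset) → reps S e ≡ 0
  reps-at-identity S = trans (reps-as-sum S e)
    (sumOver-zero (All.universal (λ g → sumOver-zero (All.universal (vanishes g) elems)) elems))
    where
    vanishes : ∀ g h → ordered S g h * δ (g ∙ h ⁻¹) e ≡ 0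
    vanishes g h with g ≟ h | (g ∙ h ⁻¹) ≟ e
    ... | yes _   | g/h≟e     = cong (_* ind (isYes g/h≟e)) (*-zeroʳ (ind (S g) * ind (S h)))
    ... | no  _   | no  _     = *-zeroʳ (ind (S g) * ind (S h) * 1)
    ... | no  g≢h | yes g/h≡e = ⊥-elim (g≢h (x∙y⁻¹≈ε⇒x≈y g h g/h≡e))

  -- For x ≠ e, the pairs (g, h) with g h⁻¹ = x are exactly the pairs (g, x⁻¹ g).
  reps-off-identity : (S : Subset) {x : Carrier} → x ≢ e →
    reps S x ≡ ∑ (λ g → ind (S g) * ind (S (x ⁻¹ ∙ g)))
  reps-off-identity S {x} x≢e = trans (reps-as-sum S x) (sumOver-cong elems inner)
    where
    pair-delta : ∀ g h → ind (not (isYes (g ≟ h))) * δ (g ∙ h ⁻¹) x ≡ δ (x ⁻¹ ∙ g) h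
    pair-delta g h with (g ∙ h ⁻¹) ≟ x
    ... | no g/h≢x = trans (*-zeroʳ (ind (not (isYes (g ≟ h))))) (sym (δ-distinct λ { refl → g/h≢x (//-solution g x) }))
    ... | yes g/h≡x with g ≟ h
    ...   | yes refl = ⊥-elim (x≢e (trans (sym g/h≡x) (inverseʳ g)))
    ...   | no  _    = sym (trans (cong (δ (x ⁻¹ ∙ g)) (//-solve g/h≡x)) (δ-self _))

    inner : ∀ g → ∑ (λ h → ordered S g h * δ (g ∙ h ⁻¹) x) ≡ ind (S g) * ind (S (x ⁻¹ ∙ g))
    inner g = trans (sumOver-cong elems λ h →
                      trans (*-assoc (ind (S g) * ind (S h)) _ _)
                            (cong (ind (S g) * ind (S h) *_) (pair-delta g h)))
                    (∑-δ (λ h → ind (S g) * ind (S h)) (x ⁻¹ ∙ g))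

  -- Every ordered pair of distinct elements of S has exactly one quotient.
  ∑-reps : (S : Subset) → ∑ (reps S) ≡ ∑ (λ g → ∑ (ordered S g))
  ∑-reps S = begin
    ∑ (reps S)
      ≡⟨ sumOver-cong elems (reps-as-sum S) ⟩
    ∑ (λ x → ∑ (λ g → ∑ (λ h → ordered S g h * δ (g ∙ h ⁻¹) x)))
      ≡⟨ sumOver-swap elems elems _ ⟩
    ∑ (λ g → ∑ (λ x → ∑ (λ h → ordered S g h * δ (g ∙ h ⁻¹) x)))
      ≡⟨ sumOver-cong elems (λ g → sumOver-swap elems elems _) ⟩
    ∑ (λ g → ∑ (λ h → ∑ (λ x → ordered S g h * δ (g ∙ h ⁻¹) x)))
      ≡⟨ sumOver-cong elems (λ g → sumOver-cong elems (λ h → ∑-δ (λ _ → ordered S g h) (g ∙ h ⁻¹))) ⟩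
    ∑ (λ g → ∑ (ordered S g)) ∎
    where open ≡-Reasoning

  ∑-diagonal : (S : Subset) → ∑ (λ g → ∑ (λ h → ind (S g) * ind (S h) * δ g h)) ≡ size S
  ∑-diagonal S = trans (sumOver-cong elems λ g → trans (∑-δ (λ h → ind (S g) * ind (S h)) g) (ind-idem (S g)))
                       (sym (size-as-sum S))

  -- Distinct pairs plus diagonal pairs are all pairs: ∑ₓ reps S x + |S| = |S|².
  sum-of-reps : (S : Subset) → ∑ (reps S) + size S ≡ size S * size S
  sum-of-reps S = begin
    ∑ (reps S) + size S
      ≡⟨ cong₂ _+_ (∑-reps S) (sym (∑-diagonal S)) ⟩
    ∑ (λ g → ∑ (ordered S g)) + ∑ (λ g → ∑ (λ h → ind (S g) * ind (S h) * δ g h))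
      ≡⟨ sym (sumOver-+ elems _ _) ⟩
    ∑ (λ g → ∑ (ordered S g) + ∑ (λ h → ind (S g) * ind (S h) * δ g h))
      ≡⟨ sumOver-cong elems (λ g → sym (sumOver-+ elems _ _)) ⟩
    ∑ (λ g → ∑ (λ h → ordered S g h + ind (S g) * ind (S h) * δ g h))
      ≡⟨ sumOver-cong elems (λ g → sumOver-cong elems (λ h → all-pairs g h)) ⟩
    ∑ (λ g → ∑ (λ h → ind (S g) * ind (S h)))
      ≡⟨ sumOver-cong elems (λ g → trans (sumOver-*ˡ elems (ind (S g)) (ind ∘ S)) (*-comm (ind (S g)) _)) ⟩
    ∑ (λ g → ∑ (ind ∘ S) * ind (S g))
      ≡⟨ sumOver-*ˡ elems (∑ (ind ∘ S)) (ind ∘ S) ⟩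
    ∑ (ind ∘ S) * ∑ (ind ∘ S)
      ≡⟨ sym (cong₂ _*_ (size-as-sum S) (size-as-sum S)) ⟩
    size S * size S ∎
    where
    open ≡-Reasoning
    all-pairs : ∀ g h → ordered S g h + ind (S g) * ind (S h) * δ g h ≡ ind (S g) * ind (S h)
    all-pairs g h = trans (sym (*-distribˡ-+ (ind (S g) * ind (S h)) _ _))
                          (trans (cong (ind (S g) * ind (S h) *_) (ind-not (isYes (g ≟ h))))
                                 (*-identityʳ _))

  -- (g h)⁻¹ g = h⁻¹: the product g h is the quotient of the pair (g, h⁻¹).
  left-quotient : ∀ g h → (g ∙ h) ⁻¹ ∙ g ≡ h ⁻¹
  left-quotient g h = sym (//-solve (cong (g ∙_) (⁻¹-involutive h)))

  reps-positive : (S : Subset) {x g : Carrier} → x ≢ e → S g ≡ true → S (x ⁻¹ ∙ g) ≡ true → 1 ≤ reps S x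
  reps-positive S {x} {g} x≢e g∈S x⁻¹g∈S =
    subst (1 ≤_) (sym (reps-off-identity S x≢e))
      (subst (_≤ ∑ (λ g → ind (S g) * ind (S (x ⁻¹ ∙ g))))
             (cong₂ (λ a b → ind a * ind b) g∈S x⁻¹g∈S)
             (term≤sumOver (λ g → ind (S g) * ind (S (x ⁻¹ ∙ g))) (elems-complete g)))

  -- For x ≠ e, the first entry of a pair with quotient x determines it, so reps S x ≤ |S|.
  reps≤size : (S : Subset) {x : Carrier} → x ≢ e → reps S x ≤ size S
  reps≤size S {x} x≢e =
    subst₂ _≤_ (sym (reps-off-identity S x≢e)) (sym (size-as-sum S)) (sumOver-mono elems bound)
    where
    bound : ∀ g → ind (S g) * ind (S (x ⁻¹ ∙ g)) ≤ ind (S g)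
    bound g = ≤-trans (*-monoʳ-≤ (ind (S g)) (ind≤1 (S (x ⁻¹ ∙ g)))) (≤-reflexive (*-identityʳ (ind (S g))))

  outside-witness : (S : Subset) → 2 * size S ≤ order → 3 ≤ order → ∃ λ x → x ≢ e × S x ≡ false
  outside-witness S half 3≤order with any? (λ x → ¬? (x ≟ e) ×-dec (S x ≟ᵇ false)) elems
  ... | yes found = satisfied found
  ... | no  none  = ⊥-elim (<⇒≱ 3≤order order≤2)
    where
    only-e-outside : ∀ x → S x ≡ false → x ≡ e
    only-e-outside x x∉S with x ≟ e
    ... | yes x≡e = x≡e
    ... | no  x≢e = ⊥-elim (All.lookup (¬Any⇒All¬ elems none) (elems-complete x) (x≢e , x∉S))

    pointwise : ∀ x → ind (not (S x)) ≤ 1 * δ e x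
    pointwise x with S x in x∈S
    ... | true  = z≤n
    ... | false rewrite only-e-outside x x∈S | δ-self e = ≤-refl

    complement≤1 : size (complement S) ≤ 1
    complement≤1 = subst₂ _≤_ (sym (size-as-sum (complement S))) (∑-δ (λ _ → 1) e)
                          (sumOver-mono elems pointwise)

    order≤2 : order ≤ 2
    order≤2 = subst (_≤ 2) (size-complement S)
      (+-mono-≤ complement≤1
        (≤-trans (+-cancelʳ-≤ (size S) (size S) _
                   (subst₂ _≤_ (cong (_+_ (size S)) (+-identityʳ (size S))) (sym (size-complement S)) half))
                 complement≤1))

module PartialDifferenceSet (G : FiniteAbelianGroup) (D : FiniteAbelianGroup.Subset G) {λ′ μ : ℕ}
  (reps-in  : ∀ x → x ≢ FiniteAbelianGroup.e G → D x ≡ true  → FiniteAbelianGroup.reps G D x ≡ λ′)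
  (reps-out : ∀ x → x ≢ FiniteAbelianGroup.e G → D x ≡ false → FiniteAbelianGroup.reps G D x ≡ μ)
  (e∉D : D (FiniteAbelianGroup.e G) ≡ false) where
  open FiniteAbelianGroup G
  open Counting G
  open import Data.Bool.Properties using (∨-zeroʳ)
  open import Algebra.Bundles using (Group)
  open Group group using (identityˡ; identityʳ)
  open import Algebra.Properties.Group group using (ε⁻¹≈ε)

  -- Summing the defining conditions over G (reps D e = 0 accounts for the missing μ at e).
  ∑-reps-pds : ∑ (reps D) + μ ≡ λ′ * size D + μ * size (complement D)
  ∑-reps-pds = begin
    ∑ (reps D) + μ
      ≡⟨ cong (_+_ (∑ (reps D))) (sym (∑-δ (λ _ → μ) e)) ⟩
    ∑ (reps D) + ∑ (λ x → μ * δ e x)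
      ≡⟨ sym (sumOver-+ elems _ _) ⟩
    ∑ (λ x → reps D x + μ * δ e x)
      ≡⟨ sumOver-cong elems pointwise ⟩
    ∑ (λ x → λ′ * ind (D x) + μ * ind (not (D x)))
      ≡⟨ sumOver-+ elems _ _ ⟩
    ∑ (λ x → λ′ * ind (D x)) + ∑ (λ x → μ * ind (not (D x)))
      ≡⟨ cong₂ _+_ (sumOver-*ˡ elems λ′ (ind ∘ D)) (sumOver-*ˡ elems μ (ind ∘ complement D)) ⟩
    λ′ * ∑ (ind ∘ D) + μ * ∑ (ind ∘ complement D)
      ≡⟨ sym (cong₂ (λ a b → λ′ * a + μ * b) (size-as-sum D) (size-as-sum (complement D))) ⟩
    λ′ * size D + μ * size (complement D) ∎
    where
    open ≡-Reasoning
    pointwise : ∀ x → reps D x + μ * δ e x ≡ λ′ * ind (D x) + μ * ind (not (D x))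
    pointwise x with x ≟ e
    ... | yes refl rewrite reps-at-identity D | e∉D | δ-self e | *-zeroʳ λ′ = refl
    ... | no  x≢e with D x in x∈D
    ...   | true  rewrite reps-in  x x≢e x∈D | δ-distinct (x≢e ∘ sym) | *-zeroʳ μ | *-identityʳ λ′ = refl
    ...   | false rewrite reps-out x x≢e x∈D | δ-distinct (x≢e ∘ sym) | *-zeroʳ μ | *-zeroʳ λ′ | *-identityʳ μ = +-identityʳ μ

  -- The standard counting identity k(k - 1) = λ′k + μ(v - k - 1), in natural-number form.
  pds-equation : size D * size D + μ ≡ λ′ * size D + μ * size (complement D) + size D
  pds-equation = begin
    size D * size D + μ       ≡⟨ cong (_+ μ) (sym (sum-of-reps D)) ⟩
    ∑ (reps D) + size D + μ   ≡⟨ +-swapʳ (∑ (reps D)) (size D) μ ⟩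
    ∑ (reps D) + μ + size D   ≡⟨ cong (_+ size D) ∑-reps-pds ⟩
    λ′ * size D + μ * size (complement D) + size D ∎
    where
    open ≡-Reasoning
    +-swapʳ : ∀ a b c → a + b + c ≡ a + c + b
    +-swapʳ = solve-∀

  -- A non-identity element outside D is represented μ times, and reps D x ≤ |D|.
  μ≤size : ∀ {x} → x ≢ e → D x ≡ false → μ ≤ size D
  μ≤size {x} x≢e x∉D = subst (_≤ size D) (reps-out x x≢e x∉D) (reps≤size D x≢e)

  -- If μ = 0 then D is closed under products (a product g h ∉ D, g h ≠ e, would be a
  -- quotient g (h⁻¹)⁻¹ of a pair of D), so a symmetric D makes D ∪ {e} a subgroup.
  subgroup-if-μ≡0 : (∀ g → D (g ⁻¹) ≡ D g) → μ ≡ 0 → IsSubgroup (withIdentity D)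
  subgroup-if-μ≡0 symmetric μ≡0 = e∈ , closed , inverse-closed
    where
    e∈ : withIdentity D e ≡ true
    e∈ rewrite e∉D = isYes-true (e ≟ e) refl

    from-D : ∀ {x} → D x ≡ true → withIdentity D x ≡ true
    from-D x∈D rewrite x∈D = refl

    from-e : ∀ {x} → x ≡ e → withIdentity D x ≡ true
    from-e refl = e∈

    members : ∀ x → withIdentity D x ≡ true → x ≡ e ⊎ D x ≡ true
    members x x∈ with D x | x ≟ e
    ... | true  | _        = inj₂ refl
    ... | false | yes x≡e  = inj₁ x≡e
    ... | false | no  _    with () ← x∈

    product : ∀ {g h} → D g ≡ true → D h ≡ true → withIdentity D (g ∙ h) ≡ true
    product {g} {h} g∈D h∈D with (g ∙ h) ≟ e | D (g ∙ h) in gh∈D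
    ... | yes _    | b     = ∨-zeroʳ b
    ... | no  _    | true  = refl
    ... | no  gh≢e | false = ⊥-elim (<⇒≱ (subst (1 ≤_) (trans (reps-out _ gh≢e gh∈D) μ≡0) at-least-one) z≤n)
      where
      at-least-one : 1 ≤ reps D (g ∙ h)
      at-least-one = reps-positive D gh≢e g∈D
        (trans (cong D (left-quotient g h)) (trans (symmetric h) h∈D))

    closed : ∀ g h → withIdentity D g ≡ true → withIdentity D h ≡ true → withIdentity D (g ∙ h) ≡ true
    closed g h g∈ h∈ with members g g∈ | members h h∈
    ... | inj₁ refl | _         = subst (λ z → withIdentity D z ≡ true) (sym (identityˡ h)) h∈
    ... | inj₂ _    | inj₁ refl = subst (λ z → withIdentity D z ≡ true) (sym (identityʳ g)) g∈
    ... | inj₂ g∈D  | inj₂ h∈D  = product g∈D h∈D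

    inverse-closed : ∀ g → withIdentity D g ≡ true → withIdentity D (g ⁻¹) ≡ true
    inverse-closed g g∈ with members g g∈
    ... | inj₁ refl = from-e ε⁻¹≈ε
    ... | inj₂ g∈D  = from-D (trans (symmetric g) g∈D)

difference-square : ∀ {a b d} → a ≡ b + d ⊎ b ≡ a + d → (+ a - + b) *ℤ (+ a - + b) ≡ + (d * d)
difference-square {b = b} {d} (inj₁ refl) = begin
  (+ (b + d) - + b) *ℤ (+ (b + d) - + b)       ≡⟨ cong (λ z → (z - + b) *ℤ (z - + b)) (ℤ.pos-+ b d) ⟩
  ((+ b +ℤ + d) - + b) *ℤ ((+ b +ℤ + d) - + b) ≡⟨ cancel (+ b) (+ d) ⟩
  + d *ℤ + d                                   ≡⟨ ℤ.pos-* d d ⟨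
  + (d * d)                                    ∎
  where
  open ≡-Reasoning
  cancel : ∀ x y → ((x +ℤ y) - x) *ℤ ((x +ℤ y) - x) ≡ y *ℤ y
  cancel = ℤ-solve-∀
difference-square {a = a} {d = d} (inj₂ refl) = begin
  (+ a - + (a + d)) *ℤ (+ a - + (a + d))       ≡⟨ cong (λ z → (+ a - z) *ℤ (+ a - z)) (ℤ.pos-+ a d) ⟩
  (+ a - (+ a +ℤ + d)) *ℤ (+ a - (+ a +ℤ + d)) ≡⟨ cancel (+ a) (+ d) ⟩
  + d *ℤ + d                                   ≡⟨ ℤ.pos-* d d ⟨
  + (d * d)                                    ∎
  where
  open ≡-Reasoning
  cancel : ∀ x y → (x - (x +ℤ y)) *ℤ (x - (x +ℤ y)) ≡ y *ℤ y
  cancel = ℤ-solve-∀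

discriminant-in-ℕ : ∀ {a b k R} → (+ a - + b) *ℤ (+ a - + b) +ℤ + 4 *ℤ (+ k - + b) ≡ + R →
  ∃ λ d → (a ≡ b + d ⊎ b ≡ a + d) × d * d + 4 * k ≡ R + 4 * b
discriminant-in-ℕ {a} {b} {k} {R} Δ≡R = d , sign , ℤ.+-injective (begin
  + (d * d + 4 * k)                                          ≡⟨ ℤ.pos-+ (d * d) (4 * k) ⟩
  + (d * d) +ℤ + (4 * k)                                     ≡⟨ cong₂ _+ℤ_ (difference-square sign) (sym (ℤ.pos-* 4 k)) ⟨
  (+ a - + b) *ℤ (+ a - + b) +ℤ + 4 *ℤ + k                   ≡⟨ shift (+ a - + b) (+ k) (+ b) ⟩
  (+ a - + b) *ℤ (+ a - + b) +ℤ + 4 *ℤ (+ k - + b) +ℤ + 4 *ℤ + b ≡⟨ cong (_+ℤ + 4 *ℤ + b) Δ≡R ⟩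
  + R +ℤ + 4 *ℤ + b                                          ≡⟨ cong (_+ℤ_ (+ R)) (ℤ.pos-* 4 b) ⟨
  + R +ℤ + (4 * b)                                           ≡⟨ ℤ.pos-+ R (4 * b) ⟨
  + (R + 4 * b)                                              ∎)
  where
  open ≡-Reasoning
  shift : ∀ x y z → x *ℤ x +ℤ + 4 *ℤ y ≡ x *ℤ x +ℤ + 4 *ℤ (y - z) +ℤ + 4 *ℤ z
  shift = ℤ-solve-∀
  d-sign : ∃ λ d → a ≡ b + d ⊎ b ≡ a + d
  d-sign with ≤-total b a
  ... | inj₁ b≤a = let (d , b+d≡a) = m≤n⇒∃[o]m+o≡n b≤a in d , inj₁ (sym b+d≡a)
  ... | inj₂ a≤b = let (d , a+d≡b) = m≤n⇒∃[o]m+o≡n a≤b in d , inj₂ (sym a+d≡b)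
  d = proj₁ d-sign
  sign = proj₂ d-sign

cancel-equal : ∀ {x y a b} → a ≡ b → x + a ≡ y + b → x ≡ y
cancel-equal {x} {y} {a} refl eq = +-cancelʳ-≡ a x y eq

even-discriminant : ∀ {d k n} → d * d + 4 * k ≡ 4 * n → ∃ λ t → d ≡ 2 * t × t * t + k ≡ n
even-discriminant {d} {k} {n} eq = t , d≡2t , *-cancelˡ-≡ (t * t + k) n 4 (begin
  4 * (t * t + k)           ≡⟨ quadruple t k ⟩
  (2 * t) * (2 * t) + 4 * k ≡⟨ cong (λ z → z * z + 4 * k) d≡2t ⟨
  d * d + 4 * k             ≡⟨ eq ⟩
  4 * n                     ∎)
  where
  open ≡-Reasoning
  double : ∀ m → 4 * m ≡ 2 * m * 2
  double = solve-∀
  quadruple : ∀ t k → 4 * (t * t + k) ≡ (2 * t) * (2 * t) + 4 * k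
  quadruple = solve-∀
  2∣d² : 2 ∣ d * d
  2∣d² = ∣m+n∣m⇒∣n (subst (2 ∣_) (sym (trans (+-comm (4 * k) (d * d)) eq)) (divides (2 * n) (double n)))
                   (divides (2 * k) (double k))
  2∣d : 2 ∣ d
  2∣d = [ id , id ]′ (euclidsLemma d d (prime 2-rough) 2∣d²)
  t = _∣_.quotient 2∣d
  d≡2t : d ≡ 2 * t
  d≡2t = trans (_∣_.equality 2∣d) (*-comm t 2)

distance-square : ∀ {Q k t} → Q + 2 * k * t ≡ k * k + t * t →
  ∃ λ A → A * A ≡ Q × (t ≡ k + A ⊎ k ≡ t + A)
distance-square {Q} {k} {t} eq with ≤-total k t
... | inj₁ k≤t with m≤n⇒∃[o]m+o≡n k≤t
...   | A , refl = A , cancel-equal eq (expand Q k A) , inj₁ refl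
  where
  expand : ∀ Q k A → A * A + (Q + 2 * k * (k + A)) ≡ Q + (k * k + (k + A) * (k + A))
  expand = solve-∀
distance-square {Q} {k} {t} eq | inj₂ t≤k with m≤n⇒∃[o]m+o≡n t≤k
...   | A , refl = A , cancel-equal eq (expand Q t A) , inj₂ refl
  where
  expand : ∀ Q t A → A * A + (Q + 2 * (t + A) * t) ≡ Q + ((t + A) * (t + A) + t * t)
  expand = solve-∀

-- With λ′ - μ = ±2t, the PDS equation and t² + k = P + μ make P + vμ a perfect square
-- A = |k ∓ t|; the result records how A, k and t are related.
discriminant-square : ∀ {k m λ′ μ t P v} → m + k ≡ v → k * k + μ ≡ λ′ * k + μ * m + k →
  t * t + k ≡ P + μ → λ′ ≡ μ + 2 * t ⊎ μ ≡ λ′ + 2 * t →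
  ∃ λ A → A * A ≡ P + v * μ × (t ≡ k + A ⊎ k ≡ t + A ⊎ A ≡ k + t)
discriminant-square {k} {m} {λ′} {μ} {t} {P} refl pds t²+k≡ (inj₁ refl) =
  let (A , A²≡ , position) = distance-square
        (cancel-equal (cong₂ _+_ pds t²+k≡) (expand k m μ t P))
  in A , A²≡ , [ inj₁ , inj₂ ∘ inj₁ ]′ position
  where
  expand : ∀ k m μ t P → (P + (m + k) * μ + 2 * k * t) + (k * k + μ + (t * t + k))
                        ≡ (k * k + t * t) + ((μ + 2 * t) * k + μ * m + k + (P + μ))
  expand = solve-∀
discriminant-square {k} {m} {λ′} {μ} {t} {P} refl pds t²+k≡ (inj₂ refl) =
  k + t , cancel-equal (sym (cong₂ _+_ pds t²+k≡)) (expand k m λ′ t P) , inj₂ (inj₂ refl)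
  where
  expand : ∀ k m λ′ t P → (k + t) * (k + t) + (λ′ * k + (λ′ + 2 * t) * m + k + (P + (λ′ + 2 * t)))
                         ≡ (P + (m + k) * (λ′ + 2 * t)) + (k * k + (λ′ + 2 * t) + (t * t + k))
  expand = solve-∀

cofactor-square : ∀ {p A n} → Prime p → A * A ≡ (p * p) * n → ∃ λ B → A ≡ B * p × B * B ≡ n
cofactor-square {p} {A} {n} pp A²≡ =
  from-divisor ([ id , id ]′ (euclidsLemma A A pp (divides (p * n) (trans A²≡ (swap p n)))))
  where
  swap : ∀ p n → (p * p) * n ≡ (p * n) * p
  swap = solve-∀
  square : ∀ B p → (p * p) * (B * B) ≡ (B * p) * (B * p)
  square = solve-∀
  instance _ = prime⇒nonZero pp
  from-divisor : p ∣ A → ∃ λ B → A ≡ B * p × B * B ≡ n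
  from-divisor (divides B refl) =
    B , refl , *-cancelˡ-≡ (B * B) n (p * p) {{m*n≢0 p p}} (trans (square B p) A²≡)

-- The quadratic B² - 8p²B + 8p³ - 1 is negative for p < B ≤ 4p² + 1, so a B ≤ 4p² + 1
-- at which it is non-negative satisfies B ≤ p.
quadratic-bound : ∀ {p B} → 1 ≤ p → B ≤ 4 * (p * p) + 1 →
  8 * (p * p) * B + 1 ≤ 8 * (p * p * p) + B * B → B ≤ p
quadratic-bound {suc q} {B} _ B≤ nonneg with B ≤? suc q
... | yes B≤p = B≤p
... | no  B≰p with m≤n⇒∃[o]m+o≡n (≰⇒> B≰p) | m≤n⇒∃[o]m+o≡n B≤ | m≤n⇒∃[o]m+o≡n nonneg
... | c , refl | e , B+e≡ | s , lhs+s≡ = ⊥-elim (m+1+n≢m _ (begin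
  X + suc (4 + 12 * q + 7 * q * q + c * (1 + 7 * q + 4 * q * q) + s + c * e)
    ≡⟨ expand q c s e ⟨
  (8 * (p * p) * B + 1 + s) + c * (B + e)
    ≡⟨ cong₂ _+_ lhs+s≡ (cong (c *_) B+e≡) ⟩
  X ∎))
  where
  open ≡-Reasoning
  p = suc q
  X = 8 * (p * p * p) + B * B + c * (4 * (p * p) + 1)
  expand : ∀ q c s e → let p = suc q ; B = suc p + c in
    (8 * (p * p) * B + 1 + s) + c * (B + e)
      ≡ (8 * (p * p * p) + B * B + c * (4 * (p * p) + 1))
        + suc (4 + 12 * q + 7 * q * q + c * (1 + 7 * q + 4 * q * q) + s + c * e)
  expand = solve-∀

odd-prime : ∀ {p m} → Prime p → 3 ≤ p → p ≢ 2 * m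
odd-prime {m = m} pp 3≤p refl with prime⇒irreducible pp (divides m (*-comm 2 m))
... | inj₁ ()
... | inj₂ 2≡p = <⇒≱ 3≤p (≤-reflexive (sym 2≡p))

small-multiple : ∀ {p n} → p ∣ n → n < p → n ≡ 0
small-multiple     (divides zero    refl) _   = refl
small-multiple {p} (divides (suc r) refl) n<p = ⊥-elim (<⇒≱ n<p (m≤m+n p (r * p)))

sole-multiple : ∀ {p n} → 2 ≤ p → p ∣ n → 0 < n → n ≤ suc p → n ≡ p
sole-multiple {p} _   (divides 1 refl) _ _ = +-identityʳ p
sole-multiple {p} 2≤p (divides (suc (suc r)) refl) _ n≤1+p =
  ⊥-elim (<⇒≱ 2≤p (≤-trans (m≤m+n p (r * p)) (+-cancelˡ-≤ p (p + r * p) 1 (subst (suc (suc r) * p ≤_) (+-comm 1 p) n≤1+p))))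

-- If B² = 1 + 8pμ with 1 ≤ B ≤ p and p an odd prime, then μ = 0: p divides (B - 1)(B + 1),
-- where B - 1 < p, and B + 1 = p would make p = 2 + 8μ even.
small-cofactor : ∀ {p B μ} → Prime p → 3 ≤ p → B ≤ p → B * B ≡ 1 + 8 * p * μ → μ ≡ 0
small-cofactor {p} {suc b} {μ} pp 3≤p B≤p B²≡ =
  by-divisor (euclidsLemma b (2 + b) pp (divides (8 * μ) factor))
  where
  instance _ = prime⇒nonZero pp
  factor : b * (2 + b) ≡ 8 * μ * p
  factor = suc-injective (trans (expand b) (trans B²≡ (cong suc (regroup p μ))))
    where
    expand : ∀ b → suc (b * (2 + b)) ≡ suc b * suc b
    expand = solve-∀
    regroup : ∀ p μ → 8 * p * μ ≡ 8 * μ * p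
    regroup = solve-∀
  by-divisor : p ∣ b ⊎ p ∣ 2 + b → μ ≡ 0
  by-divisor (inj₁ p∣b) = *-cancelˡ-≡ μ 0 8 (m*n≡0⇒m≡0 (8 * μ) p (sym 0≡8μp))
    where
    0≡8μp : 0 ≡ 8 * μ * p
    0≡8μp = subst (λ z → z * (2 + z) ≡ 8 * μ * p) (small-multiple p∣b B≤p) factor
  by-divisor (inj₂ p∣2+b) = ⊥-elim (odd-prime {m = 1 + 4 * μ} pp 3≤p p≡2[1+4μ])
    where
    2+b≡p : 2 + b ≡ p
    2+b≡p = sole-multiple (≤-trans (s≤s (s≤s z≤n)) 3≤p) p∣2+b (s≤s z≤n) (s≤s B≤p)
    b≡8μ : b ≡ 8 * μ
    b≡8μ = *-cancelʳ-≡ b (8 * μ) p (subst (λ z → b * z ≡ 8 * μ * p) 2+b≡p factor)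
    halve : ∀ μ → 2 + 8 * μ ≡ 2 * (1 + 4 * μ)
    halve = solve-∀
    p≡2[1+4μ] : p ≡ 2 * (1 + 4 * μ)
    p≡2[1+4μ] = trans (sym 2+b≡p) (trans (cong (_+_ 2) b≡8μ) (halve μ))

t≤t² : ∀ t → t ≤ t * t
t≤t² zero    = z≤n
t≤t² (suc t) = m≤m*n (suc t) (suc t)

square-root-≤ : ∀ {m n} → m * m ≤ n * n → m ≤ n
square-root-≤ {m} {n} m²≤n² with m ≤? n
... | yes m≤n = m≤n
... | no  m≰n = ⊥-elim (<⇒≱ (*-mono-< (≰⇒> m≰n) (≰⇒> m≰n)) m²≤n²)

-- In each configuration produced by discriminant-square the cofactor B of A = Bp is at
-- most p: either directly, or through quadratic-bound using 8p(t² + k) + 1 = 8p³ + B².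
cofactor≤p : ∀ {p k μ t B} → 1 ≤ p → k ≤ 4 * (p * p * p) → t ≤ p →
  t * t + k ≡ p * p + μ → B * B ≡ 1 + 8 * p * μ →
  t ≡ k + B * p ⊎ k ≡ t + B * p ⊎ B * p ≡ k + t → B ≤ p
cofactor≤p {p} {k} {μ} {t} {B} 1≤p k≤4p³ t≤p t²+k≡ B²≡ (inj₁ t≡k+Bp) =
  ≤-trans (*-cancelʳ-≤ B 1 p {{>-nonZero 1≤p}}
            (≤-trans (m≤n+m (B * p) k) (≤-trans (≤-reflexive (sym t≡k+Bp))
                     (≤-trans t≤p (≤-reflexive (sym (*-identityˡ p)))))))
          1≤p
cofactor≤p {p} {k} {μ} {t} {B} 1≤p k≤4p³ t≤p t²+k≡ B²≡ (inj₂ position) =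
  quadratic-bound 1≤p (*-cancelʳ-≤ B (4 * (p * p) + 1) p {{>-nonZero 1≤p}} Bp≤) 8p²B+1≤
  where
  open ≤-Reasoning
  expand : ∀ p μ → 8 * p * (p * p + μ) + 1 ≡ 8 * (p * p * p) + (1 + 8 * p * μ)
  expand = solve-∀
  distribute : ∀ p → (4 * (p * p) + 1) * p ≡ 4 * (p * p * p) + p
  distribute = solve-∀
  key : 8 * p * (t * t + k) + 1 ≡ 8 * (p * p * p) + B * B
  key = begin-equality
    8 * p * (t * t + k) + 1           ≡⟨ cong (λ z → 8 * p * z + 1) t²+k≡ ⟩
    8 * p * (p * p + μ) + 1           ≡⟨ expand p μ ⟩
    8 * (p * p * p) + (1 + 8 * p * μ) ≡⟨ cong (_+_ (8 * (p * p * p))) B²≡ ⟨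
    8 * (p * p * p) + B * B           ∎
  Bp≤k+t : k ≡ t + B * p ⊎ B * p ≡ k + t → B * p ≤ k + t
  Bp≤k+t (inj₁ k≡t+Bp) = ≤-trans (m≤n+m (B * p) t) (≤-trans (≤-reflexive (sym k≡t+Bp)) (m≤m+n k t))
  Bp≤k+t (inj₂ Bp≡k+t) = ≤-reflexive Bp≡k+t
  Bp≤ : B * p ≤ (4 * (p * p) + 1) * p
  Bp≤ = begin
    B * p                   ≤⟨ Bp≤k+t position ⟩
    k + t                   ≤⟨ +-mono-≤ k≤4p³ t≤p ⟩
    4 * (p * p * p) + p     ≡⟨ distribute p ⟨
    (4 * (p * p) + 1) * p   ∎
  8p²B+1≤ : 8 * (p * p) * B + 1 ≤ 8 * (p * p * p) + B * B
  8p²B+1≤ = ≤-trans (8p²B+1≤8p[t²+k]+1 position) (≤-reflexive key)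
    where
    regroup : ∀ p B → 8 * (p * p) * B ≡ 8 * p * (B * p)
    regroup = solve-∀
    expand′ : ∀ p t B → 8 * p * (t * t + (t + B * p)) + 1 ≡ 8 * (p * p) * B + 1 + 8 * p * (t * t + t)
    expand′ = solve-∀
    8p²B+1≤8p[t²+k]+1 : k ≡ t + B * p ⊎ B * p ≡ k + t → 8 * (p * p) * B + 1 ≤ 8 * p * (t * t + k) + 1
    8p²B+1≤8p[t²+k]+1 (inj₁ refl) = ≤-trans (m≤m+n _ _) (≤-reflexive (sym (expand′ p t B)))
    8p²B+1≤8p[t²+k]+1 (inj₂ Bp≡k+t) = begin
      8 * (p * p) * B + 1    ≡⟨ cong (_+ 1) (trans (regroup p B) (cong (8 * p *_) Bp≡k+t)) ⟩
      8 * p * (k + t) + 1    ≤⟨ +-monoˡ-≤ 1 (*-monoʳ-≤ (8 * p) (subst (k + t ≤_) (+-comm k (t * t)) (+-monoʳ-≤ k (t≤t² t)))) ⟩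
      8 * p * (t * t + k) + 1 ∎

μ-vanishes : ∀ {p k m λ′ μ} → Prime p → 3 ≤ p →
  m + k ≡ 8 * (p * p * p) → 2 * k ≤ 8 * (p * p * p) → μ ≤ k →
  k * k + μ ≡ λ′ * k + μ * m + k →
  (+ λ′ - + μ) *ℤ (+ λ′ - + μ) +ℤ + 4 *ℤ (+ k - + μ) ≡ + (4 * (p * p)) → μ ≡ 0
μ-vanishes {p} {k} {m} {λ′} {μ} pp 3≤p m+k≡v 2k≤v μ≤k pds Δ≡4p² =
  let (d , sign , d²+4k≡)  = discriminant-in-ℕ {λ′} {μ} {k} Δ≡4p²
      (t , d≡2t , t²+k≡)   = even-discriminant (trans d²+4k≡ (sym (*-distribˡ-+ 4 (p * p) μ)))
      (A , A²≡ , position) = discriminant-square m+k≡v pds t²+k≡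
                               (subst (λ z → λ′ ≡ μ + z ⊎ μ ≡ λ′ + z) d≡2t sign)
      (B , A≡Bp , B²≡)     = cofactor-square {p} {A} pp (trans A²≡ (factor p μ))
      t≤p = square-root-≤ (+-cancelʳ-≤ k (t * t) (p * p)
              (≤-trans (≤-reflexive t²+k≡) (+-monoʳ-≤ (p * p) μ≤k)))
  in small-cofactor {p} {B} {μ} pp 3≤p
       (cofactor≤p {p} {k} {μ} {t} {B} 1≤p k≤4p³ t≤p t²+k≡ B²≡
          (subst (λ z → t ≡ k + z ⊎ k ≡ t + z ⊎ z ≡ k + t) A≡Bp position))
       B²≡
  where
  factor : ∀ p μ → p * p + 8 * (p * p * p) * μ ≡ (p * p) * (1 + 8 * p * μ)
  factor = solve-∀
  halve : ∀ p → 8 * (p * p * p) ≡ 2 * (4 * (p * p * p))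
  halve = solve-∀
  1≤p : 1 ≤ p
  1≤p = ≤-trans (s≤s z≤n) 3≤p
  k≤4p³ : k ≤ 4 * (p * p * p)
  k≤4p³ = *-cancelˡ-≤ 2 (subst (2 * k ≤_) (halve p) 2k≤v)

proposition5 : (p : ℕ) → Prime p → 5 ≤ p →
  (G : FiniteAbelianGroup) → (D : FiniteAbelianGroup.Subset G) →
  (v k λ′ μ : ℕ) →
  FiniteAbelianGroup.IsPDS G D v k λ′ μ →
  FiniteAbelianGroup.IsRegular G D →
  ¬ FiniteAbelianGroup.IsTrivial G D →
  v ≡ 8 * p ^ 3 →
  2 * k ≤ v →
  ((+ λ′ - + μ) *ℤ (+ λ′ - + μ)) +ℤ (+ 4 *ℤ (+ k - + μ)) ≢ + (4 * p ^ 2)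
proposition5 p pp 5≤p G D v k λ′ μ (order≡v , refl , reps-in , reps-out) (symmetric , e∉D)
             nontrivial refl 2k≤v Δ≡4p² =
  nontrivial (inj₁ (subgroup-if-μ≡0 symmetric μ≡0))
  where
  open FiniteAbelianGroup G using (order; size; complement)
  open Counting G using (size-complement; outside-witness)
  open PartialDifferenceSet G D reps-in reps-out e∉D using (pds-equation; μ≤size; subgroup-if-μ≡0)
  cube : ∀ p → p * (p * (p * 1)) ≡ p * p * p
  cube = solve-∀
  order≡8p³ : order ≡ 8 * (p * p * p)
  order≡8p³ = trans order≡v (cong (8 *_) (cube p))
  3≤order : 3 ≤ order
  3≤order = ≤-trans (s≤s (s≤s (s≤s z≤n)))
    (subst (8 ≤_) (sym order≡v) (*-monoʳ-≤ 8 (^-monoˡ-≤ 3 (≤-trans (s≤s z≤n) 5≤p))))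
  μ≤k : μ ≤ size D
  μ≤k = let (x , x≢e , x∉D) = outside-witness D (subst (2 * size D ≤_) (sym order≡v) 2k≤v) 3≤order
        in μ≤size x≢e x∉D
  μ≡0 : μ ≡ 0
  μ≡0 = μ-vanishes {p} {size D} {size (complement D)} {λ′} {μ} pp (≤-trans (s≤s (s≤s (s≤s z≤n))) 5≤p)
          (trans (size-complement D) order≡8p³) (subst (2 * size D ≤_) (cong (8 *_) (cube p)) 2k≤v)
          μ≤k pds-equation (trans Δ≡4p² (cong (λ z → + (4 * (p * z))) (*-identityʳ p)))
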